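{- Let $N$ be a natural number and let $q,z,d$ be complex numbers with $z\neq d$ and such that no denominator below vanishes. Then \[ \sum_{n=1}^N \begin{bmatrix} N\\ n \end{bmatrix}_{q^2} \frac{(-1)^n(q^2;q^2)_n (z/d;q^2)_n z^nd^n q^{n^2}}{(z-d)(zq)_{2n}} = \sum_{n=1}^N \begin{bmatrix} N\\ n \end{bmatrix}_{q^2} \left( \frac{(dq)_{2n-2} z^{2n-1} q^{n(2n-1)}}{(zq)_{2n-1}} + \frac{(dq)_{2n-1} z^{2n} q^{n(2n+1)}}{(zq)_{2n}} \right)\frac{(q^2;q^2)_n}{(dzq^{2N+1};q^2)_n}. \]
   Context: For complex $x$ and base $p$: $(x;p)_0=1$, $(x;p)_n=(1-x)(1-xp)\cdots(1-xp^{n-1})$ for $n\ge1$; $(x)_n$ means $(x;q)_n$. The $q^2$-binomial coefficient is $\begin{bmatrix} N\\ n \end{bmatrix}_{q^2}=\frac{(q^2;q^2)_N}{(q^2;q^2)_n(q^2;q^2)_{N-n}}$ for $0\le n\le N$ and $0$ otherwise. -}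

module Defs where

open import Level using (_⊔_) renaming (suc to lsuc)
open import Algebra.Bundles using (CommutativeRing)
open import Data.Nat using (ℕ; zero; suc; _∸_; _≤_; _≤?_)
open import Relation.Nullary using (¬_; yes; no)
open import Relation.Binary.PropositionalEquality using (_≡_)

-- A field: a commutative ring with 1 ≠ 0 in which every nonzero element
-- has a multiplicative inverse (the value of 0⁻¹ is unconstrained).
record Field (c ℓ : Level.Level) : Set (lsuc (c ⊔ ℓ)) where
  field
    commutativeRing : CommutativeRing c ℓ
  open CommutativeRing commutativeRing public
  field
    _⁻¹        : Carrier → Carrier
    ⁻¹-inverse : ∀ x → ¬ (x ≈ 0#) → (x * (x ⁻¹)) ≈ 1#
    nontrivial : ¬ (1# ≈ 0#)

module FieldOps {c ℓ} (F : Field c ℓ) where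
  open Field F

  infixl 7 _÷_
  _÷_ : Carrier → Carrier → Carrier
  x ÷ y = x * (y ⁻¹)

  fromℕ : ℕ → Carrier
  fromℕ zero    = 0#
  fromℕ (suc n) = 1# + fromℕ n

  pow : Carrier → ℕ → Carrier
  pow x zero    = 1#
  pow x (suc n) = x * pow x n

  poch : Carrier → Carrier → ℕ → Carrier
  poch x p zero    = 1#
  poch x p (suc n) = poch x p n * (1# - x * pow p n)

  qbin2 : Carrier → ℕ → ℕ → Carrier
  qbin2 q N n with n ≤? N
  ... | yes _ = poch (q * q) (q * q) N
                  ÷ (poch (q * q) (q * q) n * poch (q * q) (q * q) (N ∸ n))
  ... | no _  = 0#

  sum1 : ℕ → (ℕ → Carrier) → Carrier
  sum1 zero    f = 0#
  sum1 (suc N) f = sum1 N f + f (suc N)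

CharZero : ∀ {c ℓ} → Field c ℓ → Set ℓ
CharZero F = ∀ n → fromℕ n ≈ 0# → n ≡ 0
  where open Field F
        open FieldOps F

-- Put b = dzq^(2N+1). Multiplying the n-th summands of both sides by (zq;q)_2N (b;q²)_N clears all
-- denominators and leaves polynomials L N z n and R N z n; on the left this uses
-- (-1)^n (z/d;q²)_n d^n = (z - d)(zq² - d)⋯(zq^(2n-2) - d). Then Σ L = Σ R by induction on N,
-- replacing z by zq², which keeps b fixed. The summands of level N+1 are a common factor κ times those
-- of level N at zq², exactly for L and for R up to a telescoping difference G(n+1) - G(n); moreover
-- R(1) = L(1) + G(1), and G vanishes at n = N+1. With u = q^2m, the heart of the step for R is
--   (1 - dqu)(1 - dq²u) zq² = (zq² - d)(1 - dzq⁵u²) + d(1 - zq³u)(1 - zq⁴u).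

{-# OPTIONS --safe #-}
module Submission where

open import Defs
open import Algebra.Bundles using (CommutativeRing)
open import Data.Nat using (ℕ; zero; suc; _≤_; _∸_; s≤s; z≤n)
import Data.Nat as Nat
import Data.Nat.Properties as ℕ
open import Data.Nat.Tactic.RingSolver using (solve-∀)
open import Relation.Binary.PropositionalEquality as ≡ using (_≡_)
open import Relation.Nullary using (¬_; yes; no; contradiction)

-- With the ring's own elements as coefficients, the only choice the library offers for a ring
-- without decidable equality, the solver cannot cancel 1# - 1#; integer coefficients can.
module IntegerCoefficients {c ℓ} (R : CommutativeRing c ℓ) where

  open import Algebra.Solver.Ring.AlmostCommutativeRing
    using (fromCommutativeRing; _-Raw-AlmostCommutative⟶_; Induced-equivalence)
  open import Relation.Binary.Definitions using (WeaklyDecidable)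
  open import Data.Integer.Base as ℤ using (ℤ; +_; -[1+_]; _⊖_; +-*-rawRing)
  import Data.Integer.Properties as ℤ
  open import Data.Maybe.Base using (just; nothing)

  open CommutativeRing R
  open import Algebra.Properties.Ring ring
    using (-0#≈0#; -‿involutive; -‿distribˡ-*; -‿distribʳ-*; -‿+-comm)
  open import Algebra.Properties.CommutativeSemigroup +-commutativeSemigroup using (interchange)
  open import Algebra.Properties.Semiring.Mult.TCOptimised semiring using (_×_; ×-homo-+; ×1-homo-*; 1+×)
  open import Relation.Binary.Reasoning.Setoid setoid

  ⟦_⟧ℤ : ℤ → Carrier
  ⟦ + n      ⟧ℤ = n × 1#
  ⟦ -[1+ n ] ⟧ℤ = - (suc n × 1#)

  ⟦-⟧ℤ : ∀ i → ⟦ ℤ.- i ⟧ℤ ≈ - ⟦ i ⟧ℤ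
  ⟦-⟧ℤ -[1+ n ]    = sym (-‿involutive _)
  ⟦-⟧ℤ (+ zero)    = sym -0#≈0#
  ⟦-⟧ℤ (+ (suc n)) = refl

  1+x-1+y≈x-y : ∀ x y → (1# + x) - (1# + y) ≈ x - y
  1+x-1+y≈x-y x y = begin
    (1# + x) - (1# + y)     ≈⟨ +-congˡ (-‿+-comm 1# y) ⟨
    (1# + x) + (- 1# - y)   ≈⟨ interchange 1# x (- 1#) (- y) ⟩
    (1# - 1#) + (x - y)     ≈⟨ +-congʳ (-‿inverseʳ 1#) ⟩
    0# + (x - y)            ≈⟨ +-identityˡ (x - y) ⟩
    x - y                   ∎

  ⟦⊖⟧ℤ : ∀ m n → ⟦ m ⊖ n ⟧ℤ ≈ m × 1# - n × 1#
  ⟦⊖⟧ℤ m       zero    = sym (trans (+-congˡ -0#≈0#) (+-identityʳ _))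
  ⟦⊖⟧ℤ zero    (suc n) = sym (+-identityˡ _)
  ⟦⊖⟧ℤ (suc m) (suc n) = begin
    ⟦ suc m ⊖ suc n ⟧ℤ            ≡⟨ ≡.cong ⟦_⟧ℤ (ℤ.[1+m]⊖[1+n]≡m⊖n m n) ⟩
    ⟦ m ⊖ n ⟧ℤ                    ≈⟨ ⟦⊖⟧ℤ m n ⟩
    m × 1# - n × 1#               ≈⟨ 1+x-1+y≈x-y (m × 1#) (n × 1#) ⟨
    (1# + m × 1#) - (1# + n × 1#) ≈⟨ +-cong (1+× m 1#) (-‿cong (1+× n 1#)) ⟨
    suc m × 1# - suc n × 1#       ∎

  ⟦+⟧ℤ : ∀ i j → ⟦ i ℤ.+ j ⟧ℤ ≈ ⟦ i ⟧ℤ + ⟦ j ⟧ℤ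
  ⟦+⟧ℤ (+ m)    (+ n)    = ×-homo-+ 1# m n
  ⟦+⟧ℤ (+ m)    -[1+ n ] = ⟦⊖⟧ℤ m (suc n)
  ⟦+⟧ℤ -[1+ m ] (+ n)    = trans (⟦⊖⟧ℤ n (suc m)) (+-comm _ _)
  ⟦+⟧ℤ -[1+ m ] -[1+ n ] = begin
    ⟦ -[1+ m ] ℤ.+ -[1+ n ] ⟧ℤ             ≡⟨ ≡.cong ⟦_⟧ℤ (ℤ.neg-distrib-+ (+ suc m) (+ suc n)) ⟨
    ⟦ ℤ.- (+ suc m ℤ.+ + suc n) ⟧ℤ         ≈⟨ ⟦-⟧ℤ (+ suc m ℤ.+ + suc n) ⟩
    - ⟦ + suc m ℤ.+ + suc n ⟧ℤ             ≈⟨ -‿cong (×-homo-+ 1# (suc m) (suc n)) ⟩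
    - (suc m × 1# + suc n × 1#)            ≈⟨ -‿+-comm _ _ ⟨
    ⟦ -[1+ m ] ⟧ℤ + ⟦ -[1+ n ] ⟧ℤ          ∎

  ⟦+m*⟧ℤ : ∀ m j → ⟦ + m ℤ.* j ⟧ℤ ≈ m × 1# * ⟦ j ⟧ℤ
  ⟦+m*⟧ℤ m (+ n)    = trans (reflexive (≡.cong ⟦_⟧ℤ (≡.sym (ℤ.pos-* m n)))) (×1-homo-* m n)
  ⟦+m*⟧ℤ m -[1+ n ] = begin
    ⟦ + m ℤ.* ℤ.- (+ suc n) ⟧ℤ   ≡⟨ ≡.cong ⟦_⟧ℤ (ℤ.neg-distribʳ-* (+ m) (+ suc n)) ⟨
    ⟦ ℤ.- (+ m ℤ.* + suc n) ⟧ℤ   ≈⟨ ⟦-⟧ℤ (+ m ℤ.* + suc n) ⟩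
    - ⟦ + m ℤ.* + suc n ⟧ℤ       ≈⟨ -‿cong (⟦+m*⟧ℤ m (+ suc n)) ⟩
    - (m × 1# * suc n × 1#)      ≈⟨ -‿distribʳ-* _ _ ⟩
    m × 1# * ⟦ -[1+ n ] ⟧ℤ       ∎

  ⟦*⟧ℤ : ∀ i j → ⟦ i ℤ.* j ⟧ℤ ≈ ⟦ i ⟧ℤ * ⟦ j ⟧ℤ
  ⟦*⟧ℤ (+ m)    j = ⟦+m*⟧ℤ m j
  ⟦*⟧ℤ -[1+ m ] j = begin
    ⟦ ℤ.- (+ suc m) ℤ.* j ⟧ℤ     ≡⟨ ≡.cong ⟦_⟧ℤ (ℤ.neg-distribˡ-* (+ suc m) j) ⟨
    ⟦ ℤ.- (+ suc m ℤ.* j) ⟧ℤ     ≈⟨ ⟦-⟧ℤ (+ suc m ℤ.* j) ⟩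
    - ⟦ + suc m ℤ.* j ⟧ℤ         ≈⟨ -‿cong (⟦+m*⟧ℤ (suc m) j) ⟩
    - (suc m × 1# * ⟦ j ⟧ℤ)      ≈⟨ -‿distribˡ-* _ _ ⟩
    ⟦ -[1+ m ] ⟧ℤ * ⟦ j ⟧ℤ       ∎

  ℤ⟶R : +-*-rawRing -Raw-AlmostCommutative⟶ fromCommutativeRing R
  ℤ⟶R = record
    { ⟦_⟧    = ⟦_⟧ℤ
    ; +-homo = ⟦+⟧ℤ
    ; *-homo = ⟦*⟧ℤ
    ; -‿homo = ⟦-⟧ℤ
    ; 0-homo = refl
    ; 1-homo = refl
    }

  coeff≟ : WeaklyDecidable (Induced-equivalence ℤ⟶R)
  coeff≟ i j with i ℤ.≟ j
  ... | yes ≡.refl = just refl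
  ... | no _       = nothing

  open import Algebra.Solver.Ring +-*-rawRing (fromCommutativeRing R) ℤ⟶R coeff≟ public

  0ₚ 1ₚ : ∀ {n} → Polynomial n
  0ₚ = con (+ 0)
  1ₚ = con (+ 1)

module FieldLemmas {c ℓ} (F : Field c ℓ) where
  open Field F hiding (zero)
  open FieldOps F
  open IntegerCoefficients commutativeRing using (solve; _:=_; _:+_; _:*_; _:-_; :-_; 1ₚ)
  open import Relation.Binary.Reasoning.Setoid setoid

  pow-+ : ∀ x m n → pow x (m Nat.+ n) ≈ pow x m * pow x n
  pow-+ x zero    n = sym (*-identityˡ _)
  pow-+ x (suc m) n = trans (*-congˡ (pow-+ x m n)) (sym (*-assoc _ _ _))

  pow-distrib-* : ∀ x y n → pow (x * y) n ≈ pow x n * pow y n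
  pow-distrib-* x y zero    = sym (*-identityˡ _)
  pow-distrib-* x y (suc n) = trans (*-congˡ (pow-distrib-* x y n))
    (solve 4 (λ x y a b → (x :* y) :* (a :* b) := (x :* a) :* (y :* b)) refl x y (pow x n) (pow y n))

  pow-2*-suc : ∀ x n → pow x (2 Nat.* suc n) ≈ x * (x * pow x (2 Nat.* n))
  pow-2*-suc x n = reflexive (≡.cong (pow x) (ℕ.*-suc 2 n))

  pow-2* : ∀ x n → pow x (2 Nat.* n) ≈ pow (x * x) n
  pow-2* x zero    = refl
  pow-2* x (suc n) = begin
    pow x (2 Nat.* suc n)           ≈⟨ pow-2*-suc x n ⟩
    x * (x * pow x (2 Nat.* n))     ≈⟨ *-congˡ (*-congˡ (pow-2* x n)) ⟩
    x * (x * pow (x * x) n)         ≈⟨ *-assoc x x (pow (x * x) n) ⟨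
    pow (x * x) (suc n)             ∎

  poch-congˡ : ∀ {x y} r n → x ≈ y → poch x r n ≈ poch y r n
  poch-congˡ r zero    x≈y = refl
  poch-congˡ r (suc n) x≈y = *-cong (poch-congˡ r n x≈y) (+-congˡ (-‿cong (*-congʳ x≈y)))

  poch-+ : ∀ x r m n → poch x r (m Nat.+ n) ≈ poch x r m * poch (x * pow r m) r n
  poch-+ x r m zero = begin
    poch x r (m Nat.+ 0)   ≡⟨ ≡.cong (poch x r) (ℕ.+-identityʳ m) ⟩
    poch x r m             ≈⟨ *-identityʳ _ ⟨
    poch x r m * 1#        ∎
  poch-+ x r m (suc n) = begin
    poch x r (m Nat.+ suc n)
      ≡⟨ ≡.cong (poch x r) (ℕ.+-suc m n) ⟩
    poch x r (m Nat.+ n) * (1# - x * pow r (m Nat.+ n))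
      ≈⟨ *-cong (poch-+ x r m n) (+-congˡ (-‿cong (*-congˡ (pow-+ r m n)))) ⟩
    poch x r m * poch (x * pow r m) r n * (1# - x * (pow r m * pow r n))
      ≈⟨ solve 5 (λ A B x a b → A :* B :* (1ₚ :- x :* (a :* b)) := A :* (B :* (1ₚ :- (x :* a) :* b))) refl
           (poch x r m) (poch (x * pow r m) r n) x (pow r m) (pow r n) ⟩
    poch x r m * poch (x * pow r m) r (suc n) ∎

  poch-sucˡ : ∀ x r n → poch x r (suc n) ≈ (1# - x) * poch (x * r) r n
  poch-sucˡ x r n = begin
    poch x r (1 Nat.+ n)          ≈⟨ poch-+ x r 1 n ⟩
    1# * (1# - x * 1#) * poch (x * (r * 1#)) r n
      ≈⟨ *-cong (solve 1 (λ x → 1ₚ :* (1ₚ :- x :* 1ₚ) := 1ₚ :- x) refl x) (poch-congˡ r n (*-congˡ (*-identityʳ r))) ⟩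
    (1# - x) * poch (x * r) r n  ∎

  sum1-cong : ∀ M {f g : ℕ → Carrier} → (∀ n → 1 ≤ n → n ≤ M → f n ≈ g n) → sum1 M f ≈ sum1 M g
  sum1-cong zero    f≈g = refl
  sum1-cong (suc M) f≈g = +-cong (sum1-cong M (λ n 1≤n n≤M → f≈g n 1≤n (ℕ.m≤n⇒m≤1+n n≤M)))
                                 (f≈g (suc M) (s≤s z≤n) ℕ.≤-refl)

  sum1-sucˡ : ∀ M (f : ℕ → Carrier) → sum1 (suc M) f ≈ f 1 + sum1 M (λ n → f (suc n))
  sum1-sucˡ zero    f = trans (+-identityˡ _) (sym (+-identityʳ _))
  sum1-sucˡ (suc M) f = trans (+-congʳ (sum1-sucˡ M f)) (+-assoc _ _ _)

  sum1-+ : ∀ M (f g : ℕ → Carrier) → sum1 M (λ n → f n + g n) ≈ sum1 M f + sum1 M g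
  sum1-+ zero    f g = sym (+-identityˡ 0#)
  sum1-+ (suc M) f g = trans (+-congʳ (sum1-+ M f g))
    (solve 4 (λ F G a b → (F :+ G) :+ (a :+ b) := (F :+ a) :+ (G :+ b)) refl (sum1 M f) (sum1 M g) (f (suc M)) (g (suc M)))

  sum1-*ˡ : ∀ M k (f : ℕ → Carrier) → sum1 M (λ n → k * f n) ≈ k * sum1 M f
  sum1-*ˡ zero    k f = sym (zeroʳ k)
  sum1-*ˡ (suc M) k f = trans (+-congʳ (sum1-*ˡ M k f)) (sym (distribˡ _ _ _))

  sum1-*ʳ : ∀ M (f : ℕ → Carrier) k → sum1 M (λ n → f n * k) ≈ sum1 M f * k
  sum1-*ʳ zero    f k = sym (zeroˡ k)
  sum1-*ʳ (suc M) f k = trans (+-congʳ (sum1-*ʳ M f k)) (sym (distribʳ _ _ _))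

  sum1-telescope : ∀ M (G : ℕ → Carrier) → sum1 M (λ n → G (suc n) - G n) ≈ G (suc M) - G 1
  sum1-telescope zero    G = sym (-‿inverseʳ (G 1))
  sum1-telescope (suc M) G = trans (+-congʳ (sum1-telescope M G))
    (solve 3 (λ a b c → (b :- a) :+ (c :- b) := c :- a) refl (G 1) (G (suc M)) (G (suc (suc M))))

  *-⁻¹-cancelʳ : ∀ {y} x → ¬ (y ≈ 0#) → x * y * y ⁻¹ ≈ x
  *-⁻¹-cancelʳ {y} x y≉0 = trans (*-assoc x y (y ⁻¹)) (trans (*-congˡ (⁻¹-inverse y y≉0)) (*-identityʳ x))

  ÷-*-cancel : ∀ {y} x → ¬ (y ≈ 0#) → x ÷ y * y ≈ x
  ÷-*-cancel {y} x y≉0 = trans (solve 3 (λ x y i → x :* i :* y := x :* y :* i) refl x y (y ⁻¹)) (*-⁻¹-cancelʳ x y≉0)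

  *-nonzero : ∀ {x y} → ¬ (x ≈ 0#) → ¬ (y ≈ 0#) → ¬ (x * y ≈ 0#)
  *-nonzero {x} {y} x≉0 y≉0 xy≈0 = x≉0 (begin
    x              ≈⟨ *-⁻¹-cancelʳ x y≉0 ⟨
    x * y * y ⁻¹   ≈⟨ *-congʳ xy≈0 ⟩
    0# * y ⁻¹      ≈⟨ zeroˡ _ ⟩
    0#             ∎)

  *-cancelʳ : ∀ {x w y} → ¬ (y ≈ 0#) → x * y ≈ w * y → x ≈ w
  *-cancelʳ {x} {w} {y} y≉0 xy≈wy = begin
    x              ≈⟨ *-⁻¹-cancelʳ x y≉0 ⟨
    x * y * y ⁻¹   ≈⟨ *-congʳ xy≈wy ⟩
    w * y * y ⁻¹   ≈⟨ *-⁻¹-cancelʳ w y≉0 ⟩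
    w              ∎

  -‿nonzero : ∀ {x y} → ¬ (x ≈ y) → ¬ (x - y ≈ 0#)
  -‿nonzero {x} {y} x≉y x-y≈0 = x≉y (begin
    x              ≈⟨ solve 2 (λ x y → x := (x :- y) :+ y) refl x y ⟩
    (x - y) + y    ≈⟨ +-congʳ x-y≈0 ⟩
    0# + y         ≈⟨ +-identityˡ y ⟩
    y              ∎)

  *-÷-clear : ∀ {y} a x e w → ¬ (y ≈ 0#) → a * x * e ≈ w * y → a * (x ÷ y) * e ≈ w
  *-÷-clear {y} a x e w y≉0 axe≈wy = begin
    a * (x ÷ y) * e   ≈⟨ solve 4 (λ a x i e → a :* (x :* i) :* e := a :* x :* e :* i) refl a x (y ⁻¹) e ⟩
    a * x * e * y ⁻¹  ≈⟨ *-congʳ axe≈wy ⟩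
    w * y * y ⁻¹      ≈⟨ *-⁻¹-cancelʳ w y≉0 ⟩
    w                 ∎

  ÷-+-÷-common : ∀ {y e} x w → ¬ (y ≈ 0#) → ¬ (y * e ≈ 0#) → (x ÷ y + w ÷ (y * e)) * (y * e) ≈ x * e + w
  ÷-+-÷-common {y} {e} x w y≉0 ye≉0 = begin
    (x ÷ y + w ÷ (y * e)) * (y * e)            ≈⟨ distribʳ (y * e) (x ÷ y) (w ÷ (y * e)) ⟩
    x ÷ y * (y * e) + w ÷ (y * e) * (y * e)    ≈⟨ +-cong (sym (*-assoc (x ÷ y) y e)) (÷-*-cancel w ye≉0) ⟩
    x ÷ y * y * e + w                          ≈⟨ +-congʳ (*-congʳ (÷-*-cancel x y≉0)) ⟩
    x * e + w                                  ∎

  qFalling : Carrier → ℕ → ℕ → Carrier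
  qFalling r N zero    = 1#
  qFalling r N (suc n) = qFalling r N n * (1# - pow r (N ∸ n))

  qFalling-suc : ∀ r N n → qFalling r (suc N) (suc n) ≈ (1# - pow r (suc N)) * qFalling r N n
  qFalling-suc r N zero    = trans (*-identityˡ _) (sym (*-identityʳ _))
  qFalling-suc r N (suc n) = trans (*-congʳ (qFalling-suc r N n)) (*-assoc _ _ _)

  poch-qFalling : ∀ r N n → n ≤ N → poch r r N ≈ qFalling r N n * poch r r (N ∸ n)
  poch-qFalling r N zero    _   = sym (*-identityˡ _)
  poch-qFalling r N (suc n) n<N = begin
    poch r r N                                 ≈⟨ poch-qFalling r N n (ℕ.<⇒≤ n<N) ⟩
    qFalling r N n * poch r r (N ∸ n)          ≡⟨ ≡.cong (λ k → qFalling r N n * poch r r k) N∸n≡1+k ⟩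
    qFalling r N n * (poch r r k * (1# - r * pow r k))
      ≈⟨ solve 3 (λ F P x → F :* (P :* x) := F :* x :* P) refl (qFalling r N n) (poch r r k) (1# - r * pow r k) ⟩
    qFalling r N n * (1# - pow r (suc k)) * poch r r k
      ≡⟨ ≡.cong (λ j → qFalling r N n * (1# - pow r j) * poch r r k) N∸n≡1+k ⟨
    qFalling r N (suc n) * poch r r k          ∎
    where
    k : ℕ
    k = N ∸ suc n
    N∸n≡1+k : N ∸ n ≡ suc k
    N∸n≡1+k = ℕ.+-∸-assoc 1 n<N

  qbin2-≤ : ∀ q N n → n ≤ N → qbin2 q N n ≈ poch (q * q) (q * q) N ÷ (poch (q * q) (q * q) n * poch (q * q) (q * q) (N ∸ n))
  qbin2-≤ q N n n≤N with n Nat.≤? N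
  ... | yes _   = refl
  ... | no  n≰N = contradiction n≤N n≰N

  qbin2-*-poch : ∀ q N n → n ≤ N → (∀ k → k ≤ N → ¬ (poch (q * q) (q * q) k ≈ 0#)) →
                 qbin2 q N n * poch (q * q) (q * q) n ≈ qFalling (q * q) N n
  qbin2-*-poch q N n n≤N pp≉0 = begin
    qbin2 q N n * Pn                   ≈⟨ *-congʳ (qbin2-≤ q N n n≤N) ⟩
    poch p p N ÷ (Pn * Pk) * Pn        ≈⟨ *-congʳ (*-congʳ (poch-qFalling p N n n≤N)) ⟩
    Fn * Pk * (Pn * Pk) ⁻¹ * Pn
      ≈⟨ solve 4 (λ F a b i → F :* b :* i :* a := F :* (a :* b) :* i) refl Fn Pn Pk ((Pn * Pk) ⁻¹) ⟩
    Fn * (Pn * Pk) * (Pn * Pk) ⁻¹      ≈⟨ *-⁻¹-cancelʳ Fn (*-nonzero (pp≉0 n n≤N) (pp≉0 (N ∸ n) (ℕ.m∸n≤m N n))) ⟩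
    Fn                                 ∎
    where
    p Pn Pk Fn : Carrier
    p  = q * q
    Pn = poch p p n
    Pk = poch p p (N ∸ n)
    Fn = qFalling p N n

  homPoch : Carrier → Carrier → Carrier → ℕ → Carrier
  homPoch d z r zero    = 1#
  homPoch d z r (suc n) = homPoch d z r n * (z * pow r n - d)

  homPoch-sucˡ : ∀ d z r n → homPoch d z r (suc n) ≈ (z - d) * homPoch d (z * r) r n
  homPoch-sucˡ d z r zero    = solve 2 (λ z d → 1ₚ :* (z :* 1ₚ :- d) := (z :- d) :* 1ₚ) refl z d
  homPoch-sucˡ d z r (suc n) = begin
    homPoch d z r (suc n) * (z * (r * pow r n) - d)       ≈⟨ *-congʳ (homPoch-sucˡ d z r n) ⟩
    (z - d) * homPoch d (z * r) r n * (z * (r * pow r n) - d)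
      ≈⟨ solve 5 (λ z d r P u → (z :- d) :* P :* (z :* (r :* u) :- d) := (z :- d) :* (P :* (z :* r :* u :- d))) refl
           z d r (homPoch d (z * r) r n) (pow r n) ⟩
    (z - d) * homPoch d (z * r) r (suc n)                 ∎

  poch-÷≈homPoch : ∀ {d} → ¬ (d ≈ 0#) → ∀ z r n → pow (- 1#) n * poch (z ÷ d) r n * pow d n ≈ homPoch d z r n
  poch-÷≈homPoch d≉0 z r zero    = trans (*-identityʳ _) (*-identityʳ _)
  poch-÷≈homPoch {d} d≉0 z r (suc n) = begin
    - 1# * pow (- 1#) n * (poch (z ÷ d) r n * (1# - z * d ⁻¹ * pow r n)) * (d * pow d n)
      ≈⟨ solve 7 (λ s P D z i u d → (:- 1ₚ :* s) :* (P :* (1ₚ :- z :* i :* u)) :* (d :* D)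
                                    := s :* P :* D :* (z :* u :* (d :* i) :- d)) refl
           (pow (- 1#) n) (poch (z ÷ d) r n) (pow d n) z (d ⁻¹) (pow r n) d ⟩
    pow (- 1#) n * poch (z ÷ d) r n * pow d n * (z * pow r n * (d * d ⁻¹) - d)
      ≈⟨ *-cong (poch-÷≈homPoch d≉0 z r n) (+-congʳ (trans (*-congˡ (⁻¹-inverse d d≉0)) (*-identityʳ _))) ⟩
    homPoch d z r (suc n)                                ∎

-- For b = dzq^(2M+1), L M z n and R M z n are the n-th summands of the two sides multiplied by
-- (zq;q)_2M (b;q²)_M, and tailz, tailb are the parts of these products beyond (zq;q)_2n and (b;q²)_n.
-- Index 0 never occurs, as sum1 starts at 1.
module Summands {c ℓ} (F : Field c ℓ) (q d b : Field.Carrier F) where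
  open Field F hiding (zero)
  open FieldOps F
  open FieldLemmas F
  open IntegerCoefficients commutativeRing using (solve; _:=_; _:+_; _:*_; _:-_; :-_; 0ₚ; 1ₚ)
  open import Relation.Binary.Reasoning.Setoid setoid

  p : Carrier
  p = q * q

  tailz : ℕ → Carrier → ℕ → Carrier
  tailz M z n = poch (z * q * pow q (2 Nat.* n)) q (2 Nat.* (M ∸ n))

  tailb : ℕ → ℕ → Carrier
  tailb M n = poch (b * pow p n) p (M ∸ n)

  tailz-shift : ∀ M z n → tailz (suc M) z (suc n) ≈ tailz M (z * p) n
  tailz-shift M z n = poch-congˡ q (2 Nat.* (M ∸ n)) (begin
    z * q * pow q (2 Nat.* suc n)       ≈⟨ *-congˡ (pow-2*-suc q n) ⟩
    z * q * (q * (q * pow q (2 Nat.* n)))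
      ≈⟨ solve 3 (λ z q u → z :* q :* (q :* (q :* u)) := z :* (q :* q) :* q :* u) refl z q (pow q (2 Nat.* n)) ⟩
    z * p * q * pow q (2 Nat.* n)       ∎)

  tailz-sucˡ : ∀ M z n → n Nat.< M →
    tailz M z n ≈ (1# - z * q * pow p n) * (1# - z * q * pow p n * q) * tailz M z (suc n)
  tailz-sucˡ M z n n<M = begin
    poch x q (2 Nat.* (M ∸ n))                     ≡⟨ ≡.cong (λ k → poch x q (2 Nat.* k)) (ℕ.+-∸-assoc 1 n<M) ⟩
    poch x q (2 Nat.* suc k)                       ≡⟨ ≡.cong (poch x q) (ℕ.*-suc 2 k) ⟩
    poch x q (suc (suc (2 Nat.* k)))               ≈⟨ poch-sucˡ x q (suc (2 Nat.* k)) ⟩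
    (1# - x) * poch (x * q) q (suc (2 Nat.* k))    ≈⟨ *-congˡ (poch-sucˡ (x * q) q (2 Nat.* k)) ⟩
    (1# - x) * ((1# - x * q) * poch (x * q * q) q (2 Nat.* k))
      ≈⟨ *-cong (+-congˡ (-‿cong x≈)) (*-cong (+-congˡ (-‿cong (*-congʳ x≈))) (poch-congˡ q (2 Nat.* k) xqq≈)) ⟩
    (1# - z * q * pow p n) * ((1# - z * q * pow p n * q) * tailz M z (suc n))
      ≈⟨ *-assoc _ _ _ ⟨
    (1# - z * q * pow p n) * (1# - z * q * pow p n * q) * tailz M z (suc n) ∎
    where
    k : ℕ
    k = M ∸ suc n
    x : Carrier
    x = z * q * pow q (2 Nat.* n)
    x≈ : x ≈ z * q * pow p n
    x≈ = *-congˡ (pow-2* q n)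
    xqq≈ : x * q * q ≈ z * q * pow q (2 Nat.* suc n)
    xqq≈ = trans (solve 3 (λ z q u → z :* q :* u :* q :* q := z :* q :* (q :* (q :* u))) refl z q (pow q (2 Nat.* n)))
                 (*-congˡ (sym (pow-2*-suc q n)))

  tailb-sucˡ : ∀ M n → n Nat.< M → tailb M n ≈ (1# - b * pow p n) * tailb M (suc n)
  tailb-sucˡ M n n<M = begin
    poch (b * pow p n) p (M ∸ n)                   ≡⟨ ≡.cong (poch (b * pow p n) p) (ℕ.+-∸-assoc 1 n<M) ⟩
    poch (b * pow p n) p (suc (M ∸ suc n))         ≈⟨ poch-sucˡ (b * pow p n) p (M ∸ suc n) ⟩
    (1# - b * pow p n) * poch (b * pow p n * p) p (M ∸ suc n)
      ≈⟨ *-congˡ (poch-congˡ p (M ∸ suc n) (solve 3 (λ b u p → b :* u :* p := b :* (p :* u)) refl b (pow p n) p)) ⟩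
    (1# - b * pow p n) * tailb M (suc n)           ∎

  tailb-suc : ∀ M n → n ≤ M → tailb (suc M) n ≈ tailb M n * (1# - b * pow p M)
  tailb-suc M n n≤M = begin
    poch x p (suc M ∸ n)                   ≡⟨ ≡.cong (poch x p) (ℕ.+-∸-assoc 1 n≤M) ⟩
    poch x p (M ∸ n) * (1# - x * pow p (M ∸ n))
      ≈⟨ *-congˡ (+-congˡ (-‿cong (trans (*-assoc _ _ _) (*-congˡ (sym (pow-+ p n (M ∸ n))))))) ⟩
    poch x p (M ∸ n) * (1# - b * pow p (n Nat.+ (M ∸ n)))
      ≡⟨ ≡.cong (λ k → poch x p (M ∸ n) * (1# - b * pow p k)) (ℕ.m+[n∸m]≡n n≤M) ⟩
    tailb M n * (1# - b * pow p M)         ∎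
    where
    x : Carrier
    x = b * pow p n

  pow-p-2* : ∀ n → pow p (2 Nat.* n) ≈ pow p n * pow p n
  pow-p-2* n = trans (pow-2* p n) (pow-distrib-* p p n)

  square-exponent-suc : ∀ m → pow q (suc (suc m) Nat.* suc (suc m)) ≈ pow q (suc m Nat.* suc m) * (q * pow p (suc m))
  square-exponent-suc m = begin
    pow q (suc (suc m) Nat.* suc (suc m))                    ≡⟨ ≡.cong (pow q) (exponent m) ⟩
    pow q (suc m Nat.* suc m Nat.+ suc (2 Nat.* suc m))      ≈⟨ pow-+ q (suc m Nat.* suc m) (suc (2 Nat.* suc m)) ⟩
    pow q (suc m Nat.* suc m) * (q * pow q (2 Nat.* suc m))  ≈⟨ *-congˡ (*-congˡ (pow-2* q (suc m))) ⟩
    pow q (suc m Nat.* suc m) * (q * pow p (suc m))          ∎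
    where
    exponent : ∀ m → suc (suc m) Nat.* suc (suc m) ≡ suc m Nat.* suc m Nat.+ suc (2 Nat.* suc m)
    exponent = solve-∀

  odd-exponent-suc : ∀ m → pow q (suc (suc m) Nat.* suc (2 Nat.* suc m))
                         ≈ pow q (suc m Nat.* suc (2 Nat.* m)) * (pow p m * pow p m * pow q 5)
  odd-exponent-suc m = begin
    pow q (suc (suc m) Nat.* suc (2 Nat.* suc m))                          ≡⟨ ≡.cong (pow q) (exponent m) ⟩
    pow q (suc m Nat.* suc (2 Nat.* m) Nat.+ (2 Nat.* m Nat.+ (2 Nat.* m Nat.+ 5)))
      ≈⟨ pow-+ q (suc m Nat.* suc (2 Nat.* m)) (2 Nat.* m Nat.+ (2 Nat.* m Nat.+ 5)) ⟩
    pow q (suc m Nat.* suc (2 Nat.* m)) * pow q (2 Nat.* m Nat.+ (2 Nat.* m Nat.+ 5))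
      ≈⟨ *-congˡ (trans (pow-+ q (2 Nat.* m) (2 Nat.* m Nat.+ 5)) (*-congˡ (pow-+ q (2 Nat.* m) 5))) ⟩
    pow q (suc m Nat.* suc (2 Nat.* m)) * (pow q (2 Nat.* m) * (pow q (2 Nat.* m) * pow q 5))
      ≈⟨ *-congˡ (trans (*-cong (pow-2* q m) (*-congʳ (pow-2* q m))) (sym (*-assoc _ _ _))) ⟩
    pow q (suc m Nat.* suc (2 Nat.* m)) * (pow p m * pow p m * pow q 5)    ∎
    where
    exponent : ∀ m → suc (suc m) Nat.* suc (2 Nat.* suc m) ≡ suc m Nat.* suc (2 Nat.* m) Nat.+ (2 Nat.* m Nat.+ (2 Nat.* m Nat.+ 5))
    exponent = solve-∀

  κ : ℕ → Carrier → Carrier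
  κ M z = (1# - pow p (suc M)) * z * q * (z * p - d) * (1# - b * pow p M)

  L : ℕ → Carrier → ℕ → Carrier
  L M z zero    = 0#
  L M z (suc m) = qFalling p M (suc m) * pow z (suc m) * pow q (suc m Nat.* suc m) * homPoch d (z * p) p m
                  * tailz M z (suc m) * poch b p M

  L-step : ∀ M z m → L (suc M) z (suc (suc m)) ≈ κ M z * L M (z * p) (suc m)
  L-step M z m = begin
    L (suc M) z (suc (suc m))
      ≈⟨ *-congʳ (*-cong (*-cong (*-cong (*-congʳ (qFalling-suc p M (suc m))) (square-exponent-suc m))
                                 (homPoch-sucˡ d (z * p) p m))
                         (tailz-shift M z (suc m))) ⟩
    (1# - P) * C * (z * Z) * (Q * (q * U)) * ((z * p - d) * Rd) * Tz * (B * (1# - b * pow p M))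
      ≈⟨ solve 13 (λ P C z Z Q q U d Rd Tz B b V →
           (1ₚ :- P) :* C :* (z :* Z) :* (Q :* (q :* U)) :* ((z :* (q :* q) :- d) :* Rd) :* Tz :* (B :* (1ₚ :- b :* V))
           := (1ₚ :- P) :* z :* q :* (z :* (q :* q) :- d) :* (1ₚ :- b :* V) :* (C :* (Z :* U) :* Q :* Rd :* Tz :* B)) refl
           P C z Z Q q U d Rd Tz B b (pow p M) ⟩
    κ M z * (C * (Z * U) * Q * Rd * Tz * B)
      ≈⟨ *-congˡ (*-congʳ (*-congʳ (*-congʳ (*-congʳ (*-congˡ (sym (pow-distrib-* z p (suc m)))))))) ⟩
    κ M z * L M (z * p) (suc m) ∎
    where
    P C Z Q U Rd Tz B : Carrier
    P = pow p (suc M)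
    C = qFalling p M (suc m)
    Z = pow z (suc m)
    Q = pow q (suc m Nat.* suc m)
    U = pow p (suc m)
    Rd = homPoch d (z * p * p) p m
    Tz = tailz M (z * p) (suc m)
    B = poch b p M

  T : ℕ → Carrier → ℕ → Carrier
  T M z zero    = 0#
  T M z (suc m) = qFalling p M (suc m) * poch (d * q) q (2 Nat.* m) * pow z (suc (2 Nat.* m))
                  * pow q (suc m Nat.* suc (2 Nat.* m)) * tailz M z (suc m) * tailb M (suc m)

  ρ : Carrier → ℕ → Carrier
  ρ z m = d * z * (pow p m * pow p m) * (q * q * q)

  R : ℕ → Carrier → ℕ → Carrier
  R M z zero    = 0#
  R M z (suc m) = T M z (suc m) * (1# - ρ z m)

  G : ℕ → Carrier → ℕ → Carrier
  G M z zero    = 0#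
  G M z (suc m) = - (T M z (suc m) * (1# - pow p (M ∸ suc m)) * ρ z m)

  G-last : ∀ M z → G (suc M) z (suc M) ≈ 0#
  G-last M z = begin
    - (T (suc M) z (suc M) * (1# - pow p (M ∸ M)) * ρ z M)
      ≡⟨ ≡.cong (λ k → - (T (suc M) z (suc M) * (1# - pow p k) * ρ z M)) (ℕ.n∸n≡0 M) ⟩
    - (T (suc M) z (suc M) * (1# - 1#) * ρ z M)
      ≈⟨ solve 2 (λ t r → :- (t :* (1ₚ :- 1ₚ) :* r) := 0ₚ) refl (T (suc M) z (suc M)) (ρ z M) ⟩
    0# ∎

  R-first : ∀ M z → b ≈ d * z * pow q (suc (2 Nat.* suc M)) → R (suc M) z 1 ≈ L (suc M) z 1 + G (suc M) z 1
  R-first M z b≈ = begin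
    R (suc M) z 1
      ≈⟨ solve 7 (λ P z q d Tz Tb V →
           let t = 1ₚ :* (1ₚ :- P) :* 1ₚ :* (z :* 1ₚ) :* (q :* 1ₚ) :* Tz :* Tb
           in t :* (1ₚ :- d :* z :* (1ₚ :* 1ₚ) :* (q :* q :* q))
              := 1ₚ :* (1ₚ :- P) :* (z :* 1ₚ) :* (q :* 1ₚ) :* 1ₚ :* Tz :* ((1ₚ :- d :* z :* (q :* (q :* q :* V))) :* Tb)
                 :+ :- (t :* (1ₚ :- V) :* (d :* z :* (1ₚ :* 1ₚ) :* (q :* q :* q)))) refl
           (pow p (suc M)) z q d (tailz (suc M) z 1) (tailb (suc M) 1) (pow p M) ⟩
    qFalling p (suc M) 1 * pow z 1 * pow q 1 * 1# * tailz (suc M) z 1 * ((1# - d * z * (q * (p * pow p M))) * tailb (suc M) 1)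
      + G (suc M) z 1
      ≈⟨ +-congʳ (*-congˡ (trans (*-congʳ (+-congˡ (-‿cong (sym b≈′)))) (sym first-factor))) ⟩
    L (suc M) z 1 + G (suc M) z 1 ∎
    where
    b≈′ : b ≈ d * z * (q * (p * pow p M))
    b≈′ = trans b≈ (*-congˡ (*-congˡ (pow-2* q (suc M))))
    first-factor : poch b p (suc M) ≈ (1# - b) * tailb (suc M) 1
    first-factor = trans (poch-sucˡ b p M) (*-congˡ (poch-congˡ p M (*-congˡ (sym (*-identityʳ p)))))

  -- B is bq^(2m+2), rewritten through b = dzq^(2M+3).
  module StepFactors (M : ℕ) (z : Carrier) (b≈ : b ≈ d * z * pow q (suc (2 Nat.* suc M))) (m : ℕ) (m<M : suc m ≤ M) where
    u W C₀ Dq Zs E Tz Tb K B t₀ t₁ t₂ : Carrier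
    u  = pow p m
    W  = pow p (M ∸ suc m)
    C₀ = qFalling p M m
    Dq = poch (d * q) q (2 Nat.* m)
    Zs = pow z (suc (2 Nat.* m))
    E  = pow q (suc m Nat.* suc (2 Nat.* m))
    Tz = tailz M (z * p) (suc m)
    Tb = tailb (suc M) (suc (suc m))
    K  = (1# - pow p (suc M)) * C₀ * Dq * Zs * E * Tz * Tb
    B  = d * z * (q * (p * (p * u * W))) * (p * u)
    t₂ = (1# - p * W) * (1# - d * q * u) * (1# - d * q * (q * u)) * (z * z) * (u * u * pow q 5)
    t₁ = (1# - z * p * q * u) * (1# - z * p * q * u * q) * (1# - B)
    t₀ = z * q * (z * p - d) * (1# - p * W) * (p * (u * u)) * (1# - B)

    M∸m≡ : M ∸ m ≡ suc (M ∸ suc m)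
    M∸m≡ = ℕ.+-∸-assoc 1 m<M

    pM∸m≈ : pow p (M ∸ m) ≈ p * W
    pM∸m≈ = reflexive (≡.cong (pow p) M∸m≡)

    pM≈ : pow p M ≈ p * u * W
    pM≈ = trans (reflexive (≡.cong (pow p) (≡.sym (ℕ.m+[n∸m]≡n m<M)))) (pow-+ p (suc m) (M ∸ suc m))

    B≈ : b * pow p (suc m) ≈ B
    B≈ = *-congʳ (trans b≈ (*-congˡ (*-congˡ (trans (pow-2* q (suc M)) (*-congˡ pM≈)))))

    tailb-peel : tailb (suc M) (suc m) ≈ (1# - B) * Tb
    tailb-peel = trans (tailb-sucˡ (suc M) (suc m) (s≤s m<M)) (*-congʳ (+-congˡ (-‿cong B≈)))

    T-lower : T (suc M) z (suc m) ≈ K * t₁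
    T-lower = trans
      (*-cong (*-cong (*-congʳ (*-congʳ (*-congʳ (qFalling-suc p M m))))
                      (trans (tailz-shift M z m) (tailz-sucˡ M (z * p) m m<M)))
              tailb-peel)
      (solve 10 (λ P C Dq Zs E a₁ a₂ Tz a₃ Tb →
         (1ₚ :- P) :* C :* Dq :* Zs :* E :* (a₁ :* a₂ :* Tz) :* (a₃ :* Tb)
         := (1ₚ :- P) :* C :* Dq :* Zs :* E :* Tz :* Tb :* (a₁ :* a₂ :* a₃)) refl
         (pow p (suc M)) C₀ Dq Zs E (1# - z * p * q * u) (1# - z * p * q * u * q) Tz (1# - B) Tb)

    qFalling-upper : qFalling p (suc M) (suc (suc m)) ≈ (1# - pow p (suc M)) * (C₀ * (1# - p * W))
    qFalling-upper = trans (qFalling-suc p M (suc m)) (*-congˡ (*-congˡ (+-congˡ (-‿cong pM∸m≈))))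

    dq-upper : poch (d * q) q (2 Nat.* suc m) ≈ Dq * (1# - d * q * u) * (1# - d * q * (q * u))
    dq-upper = trans (reflexive (≡.cong (poch (d * q) q) (ℕ.*-suc 2 m)))
                     (*-cong (*-congˡ (+-congˡ (-‿cong (*-congˡ (pow-2* q m)))))
                             (+-congˡ (-‿cong (*-congˡ (*-congˡ (pow-2* q m))))))

    T-upper : T (suc M) z (suc (suc m)) ≈ K * t₂
    T-upper = trans
      (*-cong (*-cong (*-cong (*-cong (*-cong qFalling-upper dq-upper)
                                      (reflexive (≡.cong (λ k → pow z (suc k)) (ℕ.*-suc 2 m))))
                              (odd-exponent-suc m))
                      (tailz-shift M z (suc m)))
              refl)
      (solve 12 (λ P C w Dq a₁ a₂ z Zs E v Tz Tb →
         (1ₚ :- P) :* (C :* (1ₚ :- w)) :* (Dq :* a₁ :* a₂) :* (z :* (z :* Zs)) :* (E :* v) :* Tz :* Tb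
         := (1ₚ :- P) :* C :* Dq :* Zs :* E :* Tz :* Tb :* ((1ₚ :- w) :* a₁ :* a₂ :* (z :* z) :* v)) refl
         (pow p (suc M)) C₀ (p * W) Dq (1# - d * q * u) (1# - d * q * (q * u)) z Zs E (u * u * pow q 5) Tz Tb)

    pow-zp : pow (z * p) (suc (2 Nat.* m)) ≈ Zs * (p * (u * u))
    pow-zp = trans (pow-distrib-* z p (suc (2 Nat.* m))) (*-congˡ (*-congˡ (pow-p-2* m)))

    κT : κ M z * T M (z * p) (suc m) ≈ K * t₀
    κT = begin
      κ M z * T M (z * p) (suc m)
        ≈⟨ *-congˡ (*-congʳ (*-congʳ (*-congʳ (*-cong (*-congʳ (*-congˡ (+-congˡ (-‿cong pM∸m≈)))) pow-zp)))) ⟩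
      κ M z * (C₀ * (1# - p * W) * Dq * (Zs * (p * (u * u))) * E * Tz * tailb M (suc m))
        ≈⟨ solve 14 (λ P z q d b V C w Dq Zs x E Tz Y →
             (1ₚ :- P) :* z :* q :* (z :* (q :* q) :- d) :* (1ₚ :- b :* V) :* (C :* (1ₚ :- w) :* Dq :* (Zs :* x) :* E :* Tz :* Y)
             := (1ₚ :- P) :* C :* Dq :* Zs :* E :* Tz :* (z :* q :* (z :* (q :* q) :- d) :* (1ₚ :- w) :* x)
                :* (Y :* (1ₚ :- b :* V))) refl
             (pow p (suc M)) z q d b (pow p M) C₀ (p * W) Dq Zs (p * (u * u)) E Tz (tailb M (suc m)) ⟩
      (1# - pow p (suc M)) * C₀ * Dq * Zs * E * Tz * (z * q * (z * p - d) * (1# - p * W) * (p * (u * u)))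
        * (tailb M (suc m) * (1# - b * pow p M))
        ≈⟨ *-congˡ (trans (sym (tailb-suc M (suc m) m<M)) tailb-peel) ⟩
      (1# - pow p (suc M)) * C₀ * Dq * Zs * E * Tz * (z * q * (z * p - d) * (1# - p * W) * (p * (u * u)))
        * ((1# - B) * Tb)
        ≈⟨ solve 4 (λ X Y A Tb → X :* Y :* (A :* Tb) := X :* Tb :* (Y :* A)) refl
             ((1# - pow p (suc M)) * C₀ * Dq * Zs * E * Tz) (z * q * (z * p - d) * (1# - p * W) * (p * (u * u))) (1# - B) Tb ⟩
      K * t₀ ∎

  R-step : ∀ M z → b ≈ d * z * pow q (suc (2 Nat.* suc M)) → ∀ m → suc m ≤ M →
           R (suc M) z (suc (suc m)) ≈ κ M z * R M (z * p) (suc m) + (G (suc M) z (suc (suc m)) - G (suc M) z (suc m))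
  R-step M z b≈ m m<M = begin
    T (suc M) z (suc (suc m)) * (1# - ρ z (suc m))
      ≈⟨ *-congʳ T-upper ⟩
    K * t₂ * (1# - ρ z (suc m))
      -- after cancelling K(1 - q²W)(1 - B)zq³u², the key identity of the header
      ≈⟨ solve 6 (λ K W u q z d →
           let p = q :* q ; q³ = q :* q :* q
               B = d :* z :* (q :* (p :* (p :* u :* W))) :* (p :* u)
               q⁵ = q :* (q :* (q :* (q :* (q :* 1ₚ))))
               t₂ = (1ₚ :- p :* W) :* (1ₚ :- d :* q :* u) :* (1ₚ :- d :* q :* (q :* u)) :* (z :* z) :* (u :* u :* q⁵)
               t₁ = (1ₚ :- z :* p :* q :* u) :* (1ₚ :- z :* p :* q :* u :* q) :* (1ₚ :- B)
               t₀ = z :* q :* (z :* p :- d) :* (1ₚ :- p :* W) :* (p :* (u :* u)) :* (1ₚ :- B)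
           in K :* t₂ :* (1ₚ :- d :* z :* ((p :* u) :* (p :* u)) :* q³)
              := K :* t₀ :* (1ₚ :- d :* (z :* p) :* (u :* u) :* q³)
                 :+ (:- (K :* t₂ :* (1ₚ :- W) :* (d :* z :* ((p :* u) :* (p :* u)) :* q³))
                     :- :- (K :* t₁ :* (1ₚ :- p :* W) :* (d :* z :* (u :* u) :* q³)))) refl
           K W u q z d ⟩
    K * t₀ * (1# - ρ (z * p) m) + (- (K * t₂ * (1# - W) * ρ z (suc m)) - - (K * t₁ * (1# - p * W) * ρ z m))
      ≈⟨ +-cong (trans (*-congʳ (sym κT)) (*-assoc _ _ _))
                (+-cong (-‿cong (*-congʳ (*-congʳ (sym T-upper))))
                        (-‿cong (-‿cong (*-congʳ (*-cong (sym T-lower) (+-congˡ (-‿cong (sym pM∸m≈)))))))) ⟩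
    κ M z * R M (z * p) (suc m) + (G (suc M) z (suc (suc m)) - G (suc M) z (suc m)) ∎
    where open StepFactors M z b≈ m m<M

  sum-L≈sum-R : ∀ M z → b ≈ d * z * pow q (suc (2 Nat.* M)) → sum1 M (L M z) ≈ sum1 M (R M z)
  sum-L≈sum-R zero    z b≈ = refl
  sum-L≈sum-R (suc M) z b≈ = begin
    sum1 (suc M) (L (suc M) z)                              ≈⟨ sum1-sucˡ M (L (suc M) z) ⟩
    L (suc M) z 1 + sum1 M (λ n → L (suc M) z (suc n))
      ≈⟨ +-congˡ (trans (sum1-cong M L-step′) (sum1-*ˡ M (κ M z) (L M (z * p)))) ⟩
    L (suc M) z 1 + κ M z * sum1 M (L M (z * p))            ≈⟨ +-congˡ (*-congˡ (sum-L≈sum-R M (z * p) b≈′)) ⟩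
    L (suc M) z 1 + κ M z * sum1 M (R M (z * p))
      ≈⟨ solve 3 (λ l g s → l :+ s := (l :+ g) :+ (s :+ (0ₚ :- g))) refl
           (L (suc M) z 1) (G (suc M) z 1) (κ M z * sum1 M (R M (z * p))) ⟩
    (L (suc M) z 1 + G (suc M) z 1) + (κ M z * sum1 M (R M (z * p)) + (0# - G (suc M) z 1))
      ≈⟨ +-cong (sym (R-first M z b≈)) (+-congˡ (+-congʳ (sym (G-last M z)))) ⟩
    R (suc M) z 1 + (κ M z * sum1 M (R M (z * p)) + (G (suc M) z (suc M) - G (suc M) z 1))
      ≈⟨ +-congˡ R-tail ⟨
    R (suc M) z 1 + sum1 M (λ n → R (suc M) z (suc n))      ≈⟨ sum1-sucˡ M (R (suc M) z) ⟨
    sum1 (suc M) (R (suc M) z)                              ∎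
    where
    b≈′ : b ≈ d * (z * p) * pow q (suc (2 Nat.* M))
    b≈′ = trans b≈ (trans (*-congˡ (*-congˡ (pow-2*-suc q M)))
      (solve 4 (λ d z q u → d :* z :* (q :* (q :* (q :* u))) := d :* (z :* (q :* q)) :* (q :* u)) refl d z q (pow q (2 Nat.* M))))
    L-step′ : ∀ n → 1 ≤ n → n ≤ M → L (suc M) z (suc n) ≈ κ M z * L M (z * p) n
    L-step′ (suc m) _ _ = L-step M z m
    R-step′ : ∀ n → 1 ≤ n → n ≤ M → R (suc M) z (suc n) ≈ κ M z * R M (z * p) n + (G (suc M) z (suc n) - G (suc M) z n)
    R-step′ (suc m) _ m<M = R-step M z b≈ m m<M
    R-tail : sum1 M (λ n → R (suc M) z (suc n)) ≈ κ M z * sum1 M (R M (z * p)) + (G (suc M) z (suc M) - G (suc M) z 1)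
    R-tail = begin
      sum1 M (λ n → R (suc M) z (suc n))
        ≈⟨ sum1-cong M R-step′ ⟩
      sum1 M (λ n → κ M z * R M (z * p) n + (G (suc M) z (suc n) - G (suc M) z n))
        ≈⟨ sum1-+ M (λ n → κ M z * R M (z * p) n) (λ n → G (suc M) z (suc n) - G (suc M) z n) ⟩
      sum1 M (λ n → κ M z * R M (z * p) n) + sum1 M (λ n → G (suc M) z (suc n) - G (suc M) z n)
        ≈⟨ +-cong (sum1-*ˡ M (κ M z) (R M (z * p))) (sum1-telescope M (G (suc M) z)) ⟩
      κ M z * sum1 M (R M (z * p)) + (G (suc M) z (suc M) - G (suc M) z 1) ∎

  poch-zq-split : ∀ N z n → n ≤ N → poch (z * q) q (2 Nat.* N) ≈ poch (z * q) q (2 Nat.* n) * tailz N z n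
  poch-zq-split N z n n≤N = begin
    poch (z * q) q (2 Nat.* N)                         ≡⟨ ≡.cong (λ k → poch (z * q) q (2 Nat.* k)) (ℕ.m+[n∸m]≡n n≤N) ⟨
    poch (z * q) q (2 Nat.* (n Nat.+ (N ∸ n)))         ≡⟨ ≡.cong (poch (z * q) q) (ℕ.*-distribˡ-+ 2 n (N ∸ n)) ⟩
    poch (z * q) q (2 Nat.* n Nat.+ 2 Nat.* (N ∸ n))   ≈⟨ poch-+ (z * q) q (2 Nat.* n) (2 Nat.* (N ∸ n)) ⟩
    poch (z * q) q (2 Nat.* n) * tailz N z n           ∎

  poch-b-split : ∀ N n → n ≤ N → poch b p N ≈ poch b p n * tailb N n
  poch-b-split N n n≤N = trans (reflexive (≡.cong (poch b p) (≡.sym (ℕ.m+[n∸m]≡n n≤N)))) (poch-+ b p n (N ∸ n))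

  lhs-summand : ℕ → Carrier → ℕ → Carrier
  lhs-summand N z n = qbin2 q N n *
    ((pow (- 1#) n * poch p p n * poch (z ÷ d) p n * pow z n * pow d n * pow q (n Nat.* n))
     ÷ ((z - d) * poch (z * q) q (2 Nat.* n)))

  -- k stands for 2n; as a separate argument it can be matched against 2 + 2m in rhs-bracket-combined.
  rhs-bracket : Carrier → ℕ → ℕ → Carrier
  rhs-bracket z n k =
    (poch (d * q) q (k ∸ 2) * pow z (k ∸ 1) * pow q (n Nat.* (k ∸ 1)) ÷ poch (z * q) q (k ∸ 1))
    + (poch (d * q) q (k ∸ 1) * pow z k * pow q (n Nat.* (k Nat.+ 1)) ÷ poch (z * q) q k)

  rhs-summand : ℕ → Carrier → ℕ → Carrier
  rhs-summand N z n = qbin2 q N n * rhs-bracket z n (2 Nat.* n) * (poch p p n ÷ poch b p n)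

  rhs-bracket-combined : ∀ z m k → k ≡ 2 Nat.+ 2 Nat.* m →
    ¬ (poch (z * q) q (k ∸ 1) ≈ 0#) → ¬ (poch (z * q) q k ≈ 0#) →
    rhs-bracket z (suc m) k * poch (z * q) q k
      ≈ poch (d * q) q (2 Nat.* m) * pow z (suc (2 Nat.* m)) * pow q (suc m Nat.* suc (2 Nat.* m)) * (1# - ρ z m)
  rhs-bracket-combined z m _ ≡.refl Q≉0 Qe≉0 = begin
    (Dq * Zs * E ÷ Q + Dq * (1# - d * q * pow q (2 Nat.* m)) * (z * Zs) * pow q (suc m Nat.* (suc (suc (2 Nat.* m)) Nat.+ 1))
                       ÷ (Q * e)) * (Q * e)
      ≈⟨ ÷-+-÷-common (Dq * Zs * E) _ Q≉0 Qe≉0 ⟩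
    Dq * Zs * E * e + Dq * (1# - d * q * pow q (2 Nat.* m)) * (z * Zs) * pow q (suc m Nat.* (suc (suc (2 Nat.* m)) Nat.+ 1))
      ≈⟨ +-cong (*-congˡ (+-congˡ (-‿cong (*-congˡ (*-congˡ (pow-2* q m))))))
                (*-cong (*-congʳ (*-congˡ (+-congˡ (-‿cong (*-congˡ (pow-2* q m))))))
                        (trans (reflexive (≡.cong (pow q) (exponent m)))
                               (trans (pow-+ q (suc m Nat.* suc (2 Nat.* m)) (suc (suc (2 Nat.* m))))
                                      (*-congˡ (*-congˡ (*-congˡ (pow-2* q m))))))) ⟩
    Dq * Zs * E * (1# - z * q * (q * u)) + Dq * (1# - d * q * u) * (z * Zs) * (E * (q * (q * u)))
      ≈⟨ solve 7 (λ Dq Zs E z q d u →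
           Dq :* Zs :* E :* (1ₚ :- z :* q :* (q :* u)) :+ Dq :* (1ₚ :- d :* q :* u) :* (z :* Zs) :* (E :* (q :* (q :* u)))
           := Dq :* Zs :* E :* (1ₚ :- d :* z :* (u :* u) :* (q :* q :* q))) refl Dq Zs E z q d u ⟩
    Dq * Zs * E * (1# - ρ z m) ∎
    where
    Dq Zs E Q e u : Carrier
    u  = pow p m
    Dq = poch (d * q) q (2 Nat.* m)
    Zs = pow z (suc (2 Nat.* m))
    E  = pow q (suc m Nat.* suc (2 Nat.* m))
    Q  = poch (z * q) q (suc (2 Nat.* m))
    e  = 1# - z * q * pow q (suc (2 Nat.* m))
    exponent : ∀ m → suc m Nat.* (suc (suc (2 Nat.* m)) Nat.+ 1) ≡ suc m Nat.* suc (2 Nat.* m) Nat.+ suc (suc (2 Nat.* m))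
    exponent = solve-∀

  lhs-summand-cleared : ∀ N z m → suc m ≤ N → ¬ (d ≈ 0#) → ¬ (z ≈ d) → (∀ k → k ≤ N → ¬ (poch p p k ≈ 0#)) →
    ¬ (poch (z * q) q (2 Nat.* suc m) ≈ 0#) →
    lhs-summand N z (suc m) * (poch (z * q) q (2 Nat.* N) * poch b p N) ≈ L N z (suc m)
  lhs-summand-cleared N z m n≤N d≉0 z≉d pp≉0 Q≉0 = begin
    qbin * (X ÷ Y) * (poch (z * q) q (2 Nat.* N) * PbN)  ≈⟨ *-congˡ (*-congʳ (poch-zq-split N z n n≤N)) ⟩
    qbin * (X ÷ Y) * (Q * tz * PbN)                     ≈⟨ *-÷-clear qbin X (Q * tz * PbN) (L N z n) Y≉0 X-cleared ⟩
    L N z n                                             ∎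
    where
    n : ℕ
    n = suc m
    qbin s Pn Pzd Zn dn Qn X Q Y tz PbN Rd : Carrier
    qbin = qbin2 q N n
    s    = pow (- 1#) n
    Pn   = poch p p n
    Pzd  = poch (z ÷ d) p n
    Zn   = pow z n
    dn   = pow d n
    Qn   = pow q (n Nat.* n)
    X    = s * Pn * Pzd * Zn * dn * Qn
    Q    = poch (z * q) q (2 Nat.* n)
    Y    = (z - d) * Q
    tz   = tailz N z n
    PbN  = poch b p N
    Rd   = homPoch d (z * p) p m
    Y≉0 : ¬ (Y ≈ 0#)
    Y≉0 = *-nonzero (-‿nonzero z≉d) Q≉0
    X-cleared : qbin * X * (Q * tz * PbN) ≈ L N z n * Y
    X-cleared = begin
      qbin * X * (Q * tz * PbN)
        ≈⟨ solve 10 (λ qbin s Pn Pzd Zn dn Qn Q tz PbN →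
             qbin :* (s :* Pn :* Pzd :* Zn :* dn :* Qn) :* (Q :* tz :* PbN)
             := qbin :* Pn :* Zn :* Qn :* (s :* Pzd :* dn) :* tz :* PbN :* Q) refl
             qbin s Pn Pzd Zn dn Qn Q tz PbN ⟩
      qbin * Pn * Zn * Qn * (s * Pzd * dn) * tz * PbN * Q
        ≈⟨ *-congʳ (*-congʳ (*-congʳ (*-cong (*-congʳ (*-congʳ (qbin2-*-poch q N n n≤N pp≉0)))
                                             (trans (poch-÷≈homPoch d≉0 z p n) (homPoch-sucˡ d z p m))))) ⟩
      qFalling p N n * Zn * Qn * ((z - d) * Rd) * tz * PbN * Q
        ≈⟨ solve 8 (λ C Zn Qn zd Rd tz PbN Q →
             C :* Zn :* Qn :* (zd :* Rd) :* tz :* PbN :* Q := C :* Zn :* Qn :* Rd :* tz :* PbN :* (zd :* Q)) refl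
             (qFalling p N n) Zn Qn (z - d) Rd tz PbN Q ⟩
      L N z n * Y ∎

  rhs-summand-cleared : ∀ N z m → suc m ≤ N → (∀ k → k ≤ N → ¬ (poch p p k ≈ 0#)) →
    ¬ (poch (z * q) q ((2 Nat.* suc m) ∸ 1) ≈ 0#) → ¬ (poch (z * q) q (2 Nat.* suc m) ≈ 0#) → ¬ (poch b p (suc m) ≈ 0#) →
    rhs-summand N z (suc m) * (poch (z * q) q (2 Nat.* N) * poch b p N) ≈ R N z (suc m)
  rhs-summand-cleared N z m n≤N pp≉0 Q′≉0 Q≉0 Pbn≉0 = begin
    qbin * S * (Pn ÷ Pbn) * (poch (z * q) q (2 Nat.* N) * poch b p N)
      ≈⟨ *-congˡ (*-cong (poch-zq-split N z n n≤N) (poch-b-split N n n≤N)) ⟩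
    qbin * S * (Pn ÷ Pbn) * (Q * tz * (Pbn * tb))
      ≈⟨ *-÷-clear (qbin * S) Pn (Q * tz * (Pbn * tb)) (R N z n) Pbn≉0 Pn-cleared ⟩
    R N z n ∎
    where
    n : ℕ
    n = suc m
    qbin S Pn Pbn Q tz tb Dq Zs E : Carrier
    qbin = qbin2 q N n
    S    = rhs-bracket z n (2 Nat.* n)
    Pn   = poch p p n
    Pbn  = poch b p n
    Q    = poch (z * q) q (2 Nat.* n)
    tz   = tailz N z n
    tb   = tailb N n
    Dq   = poch (d * q) q (2 Nat.* m)
    Zs   = pow z (suc (2 Nat.* m))
    E    = pow q (suc m Nat.* suc (2 Nat.* m))
    Pn-cleared : qbin * S * Pn * (Q * tz * (Pbn * tb)) ≈ R N z n * Pbn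
    Pn-cleared = begin
      qbin * S * Pn * (Q * tz * (Pbn * tb))
        ≈⟨ solve 7 (λ qbin S Pn Q tz Pbn tb →
             qbin :* S :* Pn :* (Q :* tz :* (Pbn :* tb)) := qbin :* Pn :* (S :* Q) :* tz :* tb :* Pbn) refl
             qbin S Pn Q tz Pbn tb ⟩
      qbin * Pn * (S * Q) * tz * tb * Pbn
        ≈⟨ *-congʳ (*-congʳ (*-congʳ (*-cong (qbin2-*-poch q N n n≤N pp≉0)
                                             (rhs-bracket-combined z m (2 Nat.* n) (ℕ.*-suc 2 m) Q′≉0 Q≉0)))) ⟩
      qFalling p N n * (Dq * Zs * E * (1# - ρ z m)) * tz * tb * Pbn
        ≈⟨ solve 8 (λ C Dq Zs E r tz tb Pbn →
             C :* (Dq :* Zs :* E :* r) :* tz :* tb :* Pbn := C :* Dq :* Zs :* E :* tz :* tb :* r :* Pbn) refl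
             (qFalling p N n) Dq Zs E (1# - ρ z m) tz tb Pbn ⟩
      R N z n * Pbn ∎

theorem2p9 : ∀ {c ℓ} (F : Field c ℓ) → CharZero F →
  let open Field F
      open FieldOps F
  in (N : ℕ) (q z d : Carrier) →
    ¬ (z ≈ d) →
    ¬ (d ≈ 0#) →
    (∀ k → k ≤ N → ¬ (poch (q * q) (q * q) k ≈ 0#)) →
    (∀ n → 1 ≤ n → n ≤ N → ¬ (poch (z * q) q (2 Nat.* n) ≈ 0#)) →
    (∀ n → 1 ≤ n → n ≤ N → ¬ (poch (z * q) q ((2 Nat.* n) Nat.∸ 1) ≈ 0#)) →
    (∀ n → 1 ≤ n → n ≤ N → ¬ (poch (d * z * pow q ((2 Nat.* N) Nat.+ 1)) (q * q) n ≈ 0#)) →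
    sum1 N (λ n → qbin2 q N n *
        ((pow (- 1#) n * poch (q * q) (q * q) n * poch (z ÷ d) (q * q) n
            * pow z n * pow d n * pow q (n Nat.* n))
         ÷ ((z - d) * poch (z * q) q (2 Nat.* n))))
    ≈
    sum1 N (λ n → qbin2 q N n *
        ((poch (d * q) q ((2 Nat.* n) Nat.∸ 2) * pow z ((2 Nat.* n) Nat.∸ 1) * pow q (n Nat.* ((2 Nat.* n) Nat.∸ 1))
            ÷ poch (z * q) q ((2 Nat.* n) Nat.∸ 1))
         + (poch (d * q) q ((2 Nat.* n) Nat.∸ 1) * pow z (2 Nat.* n) * pow q (n Nat.* ((2 Nat.* n) Nat.+ 1))
            ÷ poch (z * q) q (2 Nat.* n)))
        * (poch (q * q) (q * q) n ÷ poch (d * z * pow q ((2 Nat.* N) Nat.+ 1)) (q * q) n))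
theorem2p9 F _ zero    q z d _ _ _ _ _ _ = Field.refl F
theorem2p9 F _ (suc M) q z d z≉d d≉0 pp≉0 Q≉0 Q′≉0 Pb≉0 = *-cancelʳ D≉0 (begin
  sum1 N (lhs-summand N z) * D            ≈⟨ sum1-*ʳ N (lhs-summand N z) D ⟨
  sum1 N (λ n → lhs-summand N z n * D)    ≈⟨ sum1-cong N lhs-cleared ⟩
  sum1 N (L N z)                          ≈⟨ sum-L≈sum-R N z b≈ ⟩
  sum1 N (R N z)                          ≈⟨ sum1-cong N rhs-cleared ⟨
  sum1 N (λ n → rhs-summand N z n * D)    ≈⟨ sum1-*ʳ N (rhs-summand N z) D ⟩
  sum1 N (rhs-summand N z) * D            ∎)
  where
  open Field F hiding (zero)
  open FieldOps F
  open FieldLemmas F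
  open import Relation.Binary.Reasoning.Setoid setoid
  N : ℕ
  N = suc M
  b D : Carrier
  b = d * z * pow q ((2 Nat.* N) Nat.+ 1)
  D = poch (z * q) q (2 Nat.* N) * poch b (q * q) N
  open Summands F q d b
  b≈ : b ≈ d * z * pow q (suc (2 Nat.* N))
  b≈ = reflexive (≡.cong (λ k → d * z * pow q k) (ℕ.+-comm (2 Nat.* N) 1))
  D≉0 : ¬ (D ≈ 0#)
  D≉0 = *-nonzero (Q≉0 N (s≤s z≤n) ℕ.≤-refl) (Pb≉0 N (s≤s z≤n) ℕ.≤-refl)
  lhs-cleared : ∀ n → 1 ≤ n → n ≤ N → lhs-summand N z n * D ≈ L N z n
  lhs-cleared (suc m) 1≤n n≤N = lhs-summand-cleared N z m n≤N d≉0 z≉d pp≉0 (Q≉0 (suc m) 1≤n n≤N)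
  rhs-cleared : ∀ n → 1 ≤ n → n ≤ N → rhs-summand N z n * D ≈ R N z n
  rhs-cleared (suc m) 1≤n n≤N =
    rhs-summand-cleared N z m n≤N pp≉0 (Q′≉0 (suc m) 1≤n n≤N) (Q≉0 (suc m) 1≤n n≤N) (Pb≉0 (suc m) 1≤n n≤N)
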